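{- Let $m,n$ be positive integers with $m\le n$, and write $[a,b]=\{a,a+1,\ldots,b\}$. Then $\ell_q([m,n])\ge \ell_q([1,n])$.
   Context: All graphs are finite and simple. The degree set of a graph is the set of distinct degrees of its vertices. For a finite nonempty set $\mathscr D$ of positive integers, $\ell_q(\mathscr D)$ denotes the least number of edges of a simple graph whose degree set is exactly $\mathscr D$. -}

module Defs where

open import Data.Nat using (ℕ; zero; suc; _+_; _≤_; _<ᵇ_)
open import Data.Bool using (Bool; true; false; _∧_; if_then_else_)
open import Data.Fin using (Fin; toℕ)
import Data.Fin as F
open import Data.Product using (Σ; _×_; ∃)
open import Relation.Binary.PropositionalEquality using (_≡_)
open import Function.Bundles using (_⇔_)

sumFin : (k : ℕ) → (Fin k → ℕ) → ℕ
sumFin zero    f = 0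
sumFin (suc k) f = f F.zero + sumFin k (λ i → f (F.suc i))

count : (k : ℕ) → (Fin k → Bool) → ℕ
count k p = sumFin k (λ i → if p i then 1 else 0)

record Graph : Set where
  field
    order  : ℕ
    adj    : Fin order → Fin order → Bool
    sym    : ∀ i j → adj i j ≡ adj j i
    irrefl : ∀ i → adj i i ≡ false

open Graph public

degree : (G : Graph) → Fin (order G) → ℕ
degree G i = count (order G) (adj G i)

-- number of edges: unordered adjacent pairs {i,j}, counted once via i < j
edges : Graph → ℕ
edges G = sumFin (order G) (λ i → count (order G) (λ j → adj G i j ∧ (toℕ i <ᵇ toℕ j)))

HasDegreeSet : Graph → (ℕ → Set) → Set
HasDegreeSet G D = ∀ d → (∃ λ i → degree G i ≡ d) ⇔ D d

Interval : ℕ → ℕ → ℕ → Set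
Interval a b d = a ≤ d × d ≤ b

IsLq : (ℕ → Set) → ℕ → Set
IsLq D k = (Σ Graph λ G → HasDegreeSet G D × edges G ≡ k)
         × (∀ G → HasDegreeSet G D → k ≤ edges G)

-- If G has degree set [m, n] then, for every j < n/2, at least j + 1 vertices have degree at
-- least n − j: the degrees n, n − 1, …, n − j all occur, unless n − j < m, in which case every
-- vertex qualifies and there are more than n of them.  Deleting the edges at a vertex of degree
-- at least n removes at least n edges and lowers every other degree by at most one, so the same
-- holds with n − 2 in place of n.  Hence G has at least n + (n − 2) + (n − 4) + ⋯ edges.  The
-- graph on {0, …, n} with i ~ j iff i ≠ j and i + j ≤ n has degree set [1, n] (vertex i has
-- degree n − i or n + 1 − i according as 2i ≤ n or not) and, counting each edge at its smaller
-- end, at most that many edges.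

module Submission where

open import Defs hiding (sym)
open import Data.Nat
open import Data.Nat.Properties
open import Data.Bool using (Bool; true; false; _∧_; not; if_then_else_; T)
open import Data.Bool.Properties using (T-≡; T-∧; ∧-comm; ∧-zeroʳ)
open import Data.Fin using (Fin; toℕ; fromℕ<) renaming (zero to fzero; suc to fsuc)
open import Data.Fin.Properties using (toℕ-injective; toℕ-fromℕ<; toℕ<n; toℕ≤pred[n])
  renaming (suc-injective to fsuc-injective)
open import Data.Product using (_×_; _,_; ∃; proj₁; proj₂)
open import Data.Empty using (⊥-elim)
open import Data.Unit using (tt)
open import Relation.Nullary using (¬_; yes; no)
open import Relation.Nullary.Reflects using (ofʸ; ofⁿ)
open import Relation.Binary.PropositionalEquality
open import Function.Bundles using (Equivalence; mk⇔)
open Equivalence using (to; from)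
open import Function using (_∘_)
open import Algebra.Properties.CommutativeSemigroup +-commutativeSemigroup using (interchange)

⟦_⟧ : Bool → ℕ
⟦ b ⟧ = if b then 1 else 0

⟦⟧-mono : ∀ {b c} → (T b → T c) → ⟦ b ⟧ ≤ ⟦ c ⟧
⟦⟧-mono {false}         _ = z≤n
⟦⟧-mono {true}  {true}  _ = ≤-refl
⟦⟧-mono {true}  {false} f = ⊥-elim (f tt)

⟦⟧≤1 : ∀ b → ⟦ b ⟧ ≤ 1
⟦⟧≤1 false = z≤n
⟦⟧≤1 true  = ≤-refl

infix 4 _==_
_==_ : ∀ {k} → Fin k → Fin k → Bool
fzero  == fzero  = true
fzero  == fsuc _ = false
fsuc _ == fzero  = false
fsuc i == fsuc j = i == j

==-refl : ∀ {k} (i : Fin k) → (i == i) ≡ true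
==-refl fzero    = refl
==-refl (fsuc i) = ==-refl i

==-sym : ∀ {k} (i j : Fin k) → (i == j) ≡ (j == i)
==-sym fzero    fzero    = refl
==-sym fzero    (fsuc j) = refl
==-sym (fsuc i) fzero    = refl
==-sym (fsuc i) (fsuc j) = ==-sym i j

==⇒≡ : ∀ {k} (i j : Fin k) → (i == j) ≡ true → i ≡ j
==⇒≡ fzero    fzero    _ = refl
==⇒≡ (fsuc i) (fsuc j) e = cong fsuc (==⇒≡ i j e)

≢⇒==-false : ∀ {k} {i j : Fin k} → i ≢ j → (i == j) ≡ false
≢⇒==-false {i = i} {j} i≢j with i == j in e
... | true  = ⊥-elim (i≢j (==⇒≡ i j e))
... | false = refl

sumFin-cong : ∀ k {f g : Fin k → ℕ} → (∀ i → f i ≡ g i) → sumFin k f ≡ sumFin k g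
sumFin-cong zero    _ = refl
sumFin-cong (suc k) e = cong₂ _+_ (e fzero) (sumFin-cong k (λ i → e (fsuc i)))

sumFin-mono : ∀ k {f g : Fin k → ℕ} → (∀ i → f i ≤ g i) → sumFin k f ≤ sumFin k g
sumFin-mono zero    _ = z≤n
sumFin-mono (suc k) h = +-mono-≤ (h fzero) (sumFin-mono k (λ i → h (fsuc i)))

sumFin-+ : ∀ k (f g : Fin k → ℕ) → sumFin k (λ i → f i + g i) ≡ sumFin k f + sumFin k g
sumFin-+ zero    f g = refl
sumFin-+ (suc k) f g =
  trans (cong (f fzero + g fzero +_) (sumFin-+ k (λ i → f (fsuc i)) (λ i → g (fsuc i))))
        (interchange (f fzero) (g fzero) _ _)

sumFin-zero : ∀ k → sumFin k (λ _ → 0) ≡ 0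
sumFin-zero zero    = refl
sumFin-zero (suc k) = sumFin-zero k

sumFin-if : ∀ k b (f : Fin k → ℕ) →
            (if b then sumFin k f else 0) ≡ sumFin k (λ j → if b then f j else 0)
sumFin-if k true  f = refl
sumFin-if k false f = sym (sumFin-zero k)

sumFin-select : ∀ {k} (u : Fin k) (f : Fin k → ℕ) →
                sumFin k (λ i → if i == u then f i else 0) ≡ f u
sumFin-select {suc k} fzero    f = trans (cong (f fzero +_) (sumFin-zero k)) (+-identityʳ (f fzero))
sumFin-select         (fsuc u) f = sumFin-select u (λ i → f (fsuc i))

count-cong : ∀ k {p q : Fin k → Bool} → (∀ i → p i ≡ q i) → count k p ≡ count k q
count-cong k e = sumFin-cong k (λ i → cong ⟦_⟧ (e i))

count-true : ∀ k → count k (λ _ → true) ≡ k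
count-true zero    = refl
count-true (suc k) = cong suc (count-true k)

count-mono : ∀ k {p q : Fin k → Bool} → (∀ i → T (p i) → T (q i)) → count k p ≤ count k q
count-mono zero    _ = z≤n
count-mono (suc k) h = +-mono-≤ (⟦⟧-mono (h fzero)) (count-mono k (λ i → h (fsuc i)))

count-< : ∀ {k} {p q : Fin k → Bool} (v : Fin k) →
          (∀ i → T (p i) → T (q i)) → ¬ T (p v) → T (q v) → count k p < count k q
count-< {suc k} {p} {q} fzero h ¬pv qv with p fzero | q fzero
... | true  | _     = ⊥-elim (¬pv tt)
... | false | false = ⊥-elim qv
... | false | true  = s≤s (count-mono k (λ i → h (fsuc i)))
count-< (fsuc v) h ¬pv qv = +-mono-≤-< (⟦⟧-mono (h fzero)) (count-< v (λ i → h (fsuc i)) ¬pv qv)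

count-except : ∀ {k} {p q : Fin k → Bool} (u : Fin k) →
               (∀ i → i ≢ u → T (p i) → T (q i)) → count k p ≤ suc (count k q)
count-except {suc k} {p} {q} fzero h =
  +-mono-≤ (⟦⟧≤1 (p fzero)) (≤-trans (count-mono k (λ i → h (fsuc i) (λ ()))) (m≤n+m _ ⟦ q fzero ⟧))
count-except {q = q} (fsuc u) h = ≤-trans
  (+-mono-≤ (⟦⟧-mono (h fzero (λ ())))
            (count-except u (λ i i≢u → h (fsuc i) (i≢u ∘ fsuc-injective))))
  (≤-reflexive (+-suc ⟦ q fzero ⟧ _))

count-witness : ∀ k {p : Fin k → Bool} → 0 < count k p → ∃ λ i → T (p i)
count-witness (suc k) {p} pos with p fzero in e
... | true  = fzero , from T-≡ e
... | false with i , pi ← count-witness k pos = fsuc i , pi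

count-remove : ∀ {k} (i : Fin k) (p : Fin k → Bool) →
               count k (λ j → not (i == j) ∧ p j) + ⟦ p i ⟧ ≡ count k p
count-remove fzero    p = +-comm _ ⟦ p fzero ⟧
count-remove (fsuc i) p =
  trans (+-assoc ⟦ p fzero ⟧ _ _) (cong (⟦ p fzero ⟧ +_) (count-remove i (λ j → p (fsuc j))))

count-below : ∀ k b → b ≤ k → count k (λ j → toℕ j <ᵇ b) ≡ b
count-below zero    zero    _         = refl
count-below (suc k) zero    _         = sumFin-zero k
count-below (suc k) (suc b) (s≤s b≤k) = cong suc (count-below k b b≤k)

<ᵇ-suc : ∀ a j → (a <ᵇ suc j) ≡ (a ≤ᵇ j)
<ᵇ-suc zero    j = refl
<ᵇ-suc (suc a) j = refl

count-interval : ∀ k a b → count k (λ j → (a ≤ᵇ toℕ j) ∧ (toℕ j <ᵇ b)) ≤ b ∸ a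
count-interval zero    a       b       = z≤n
count-interval (suc k) a       zero    = ≤-trans
  (count-mono (suc k) {q = λ _ → false} (λ j h → proj₂ (to (T-∧ {a ≤ᵇ toℕ j}) h)))
  (≤-reflexive (trans (sumFin-zero (suc k)) (sym (0∸n≡0 a))))
count-interval (suc k) zero    (suc b) = s≤s (count-interval k zero b)
count-interval (suc k) (suc a) (suc b) = ≤-trans
  (≤-reflexive (count-cong k (λ j → cong (_∧ (toℕ j <ᵇ b)) (<ᵇ-suc a (toℕ j)))))
  (count-interval k a b)

atLeast : Graph → ℕ → ℕ
atLeast G t = count (order G) (λ v → t ≤ᵇ degree G v)

degree<order : (G : Graph) (v : Fin (order G)) → degree G v < order G
degree<order G v = subst (degree G v <_) (count-true (order G))
  (count-< v (λ _ _ → tt) (λ adj-vv → subst T (Graph.irrefl G v) adj-vv) tt)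

atLeast-drop : (G : Graph) (v : Fin (order G)) {t : ℕ} → degree G v ≡ t →
               suc (atLeast G (suc t)) ≤ atLeast G t
atLeast-drop G v {t} dv = count-< v
  (λ i h → ≤⇒≤ᵇ (≤-trans (n≤1+n t) (≤ᵇ⇒≤ (suc t) _ h)))
  (λ h → <-irrefl (sym dv) (≤ᵇ⇒≤ (suc t) _ h))
  (≤⇒≤ᵇ (≤-reflexive (sym dv)))

atLeast-all : (G : Graph) (t : ℕ) → (∀ v → t ≤ degree G v) → order G ≤ atLeast G t
atLeast-all G t t≤ =
  subst (_≤ atLeast G t) (count-true (order G)) (count-mono (order G) (λ v _ → ≤⇒≤ᵇ (t≤ v)))

atLeast-realised : (G : Graph) → ∀ k t →
  (∀ d → t ≤ d → d ≤ t + k → ∃ λ v → degree G v ≡ d) → suc k ≤ atLeast G t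
atLeast-realised G zero    t realised =
  ≤-trans (s≤s z≤n) (atLeast-drop G _ (proj₂ (realised t ≤-refl (m≤m+n t 0))))
atLeast-realised G (suc k) t realised =
  ≤-trans (s≤s (atLeast-realised G k (suc t) realised-above))
          (atLeast-drop G _ (proj₂ (realised t ≤-refl (m≤m+n t (suc k)))))
  where
  realised-above : ∀ d → suc t ≤ d → d ≤ suc t + k → ∃ λ v → degree G v ≡ d
  realised-above d t<d d≤ =
    realised d (≤-trans (n≤1+n t) t<d) (subst (d ≤_) (sym (+-suc t k)) d≤)

isolate : (G : Graph) → Fin (order G) → Graph
isolate G u = record
  { order  = order G
  ; adj    = λ i j → (not (i == u) ∧ not (j == u)) ∧ adj G i j
  ; sym    = λ i j → cong₂ _∧_ (∧-comm (not (i == u)) _) (Graph.sym G i j)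
  ; irrefl = λ i → trans (cong (_ ∧_) (Graph.irrefl G i)) (∧-zeroʳ _)
  }

adj-isolate : (G : Graph) (u : Fin (order G)) {i j : Fin (order G)} →
              i ≢ u → j ≢ u → adj (isolate G u) i j ≡ adj G i j
adj-isolate G u i≢u j≢u rewrite ≢⇒==-false i≢u | ≢⇒==-false j≢u = refl

degree-isolate : (G : Graph) (u v : Fin (order G)) → v ≢ u →
                 degree G v ≤ suc (degree (isolate G u) v)
degree-isolate G u v v≢u =
  count-except u (λ j j≢u h → subst T (sym (adj-isolate G u v≢u j≢u)) h)

atLeast-isolate : (G : Graph) (u : Fin (order G)) (t : ℕ) →
                  atLeast G (suc t) ≤ suc (atLeast (isolate G u) t)
atLeast-isolate G u t = count-except u (λ v v≢u h →
  ≤⇒≤ᵇ (≤-pred (≤-trans (≤ᵇ⇒≤ (suc t) _ h) (degree-isolate G u v v≢u))))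

upper : (G : Graph) → Fin (order G) → Fin (order G) → ℕ
upper G i j = ⟦ adj G i j ∧ (toℕ i <ᵇ toℕ j) ⟧

degree-split : (G : Graph) (u : Fin (order G)) →
  degree G u ≤ sumFin (order G) (upper G u) + sumFin (order G) (λ i → upper G i u)
degree-split G u = ≤-trans (sumFin-mono (order G) split) (≤-reflexive (sumFin-+ (order G) _ _))
  where
  split : ∀ j → ⟦ adj G u j ⟧ ≤ upper G u j + upper G j u
  split j rewrite Graph.sym G j u with adj G u j in e
  ... | false = z≤n
  ... | true with toℕ u <ᵇ toℕ j | <ᵇ-reflects-< (toℕ u) (toℕ j)
               | toℕ j <ᵇ toℕ u | <ᵇ-reflects-< (toℕ j) (toℕ u)
  ...   | true  | _        | _     | _        = s≤s z≤n
  ...   | false | _        | true  | _        = ≤-refl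
  ...   | false | ofⁿ u≮j | false | ofⁿ j≮u =
    ⊥-elim (subst T (trans (cong (adj G u) (sym u≡j)) (Graph.irrefl G u)) (from T-≡ e))
    where u≡j = toℕ-injective (≤-antisym (≮⇒≥ j≮u) (≮⇒≥ u≮j))

upper-isolate : (G : Graph) (u i j : Fin (order G)) →
  (if i == u then upper G u j else 0) + (if j == u then upper G i u else 0) + upper (isolate G u) i j
    ≤ upper G i j
upper-isolate G u i j with i == u in i=u | j == u in j=u
... | true  | true  with refl ← ==⇒≡ i u i=u | refl ← ==⇒≡ j u j=u
  rewrite Graph.irrefl G u = z≤n
... | true  | false with refl ← ==⇒≡ i u i=u =
  ≤-reflexive (trans (+-identityʳ _) (+-identityʳ _))
... | false | true  with refl ← ==⇒≡ j u j=u = ≤-reflexive (+-identityʳ _)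
... | false | false = ≤-refl

edges-isolate : (G : Graph) (u : Fin (order G)) → degree G u + edges (isolate G u) ≤ edges G
edges-isolate G u = begin
  degree G u + edges G′
    ≤⟨ +-monoˡ-≤ (edges G′) (degree-split G u) ⟩
  sumFin N (upper G u) + sumFin N (λ i → upper G i u) + edges G′
    ≡⟨ cong₂ (λ a b → a + b + edges G′) at-row-u at-column-u ⟩
  ΣΣ (λ i j → if i == u then upper G u j else 0)
    + ΣΣ (λ i j → if j == u then upper G i u else 0) + ΣΣ (upper G′)
    ≡⟨ sym (trans (ΣΣ-+ _ _) (cong (_+ ΣΣ (upper G′)) (ΣΣ-+ _ _))) ⟩
  ΣΣ (λ i j → (if i == u then upper G u j else 0) + (if j == u then upper G i u else 0)
               + upper G′ i j)
    ≤⟨ sumFin-mono N (λ i → sumFin-mono N (upper-isolate G u i)) ⟩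
  edges G ∎
  where
  open ≤-Reasoning
  N = order G
  G′ = isolate G u
  ΣΣ : (Fin N → Fin N → ℕ) → ℕ
  ΣΣ f = sumFin N (λ i → sumFin N (f i))
  ΣΣ-+ : ∀ f g → ΣΣ (λ i j → f i j + g i j) ≡ ΣΣ f + ΣΣ g
  ΣΣ-+ f g = trans (sumFin-cong N (λ i → sumFin-+ N (f i) (g i))) (sumFin-+ N _ _)
  at-row-u : sumFin N (upper G u) ≡ ΣΣ (λ i j → if i == u then upper G u j else 0)
  at-row-u = trans (sym (sumFin-select u (λ _ → sumFin N (upper G u))))
                   (sumFin-cong N (λ i → sumFin-if N (i == u) (upper G u)))
  at-column-u : sumFin N (λ i → upper G i u) ≡ ΣΣ (λ i j → if j == u then upper G i u else 0)
  at-column-u = sumFin-cong N (λ i → sym (sumFin-select u (λ _ → upper G i u)))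

staircase : ℕ → ℕ → ℕ
staircase n zero    = 0
staircase n (suc k) = n + staircase (n ∸ 2) k

StaircaseDegrees : Graph → ℕ → Set
StaircaseDegrees G n = ∀ j → 2 * j < n → suc j ≤ atLeast G (n ∸ j)

2*j<n⇒j≤n : ∀ j {n} → 2 * j < n → j ≤ n
2*j<n⇒j≤n j 2j<n = ≤-trans (m≤m+n j (j + 0)) (<⇒≤ 2j<n)

StaircaseDegrees-isolate : ∀ n (G : Graph) (u : Fin (order G)) →
  StaircaseDegrees G n → StaircaseDegrees (isolate G u) (n ∸ 2)
StaircaseDegrees-isolate zero          G u h j ()
StaircaseDegrees-isolate (suc zero)    G u h j ()
StaircaseDegrees-isolate (suc (suc n)) G u h j 2j<n = ≤-pred (begin
  suc (suc j)                       ≤⟨ h (suc j) 2[1+j]<2+n ⟩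
  atLeast G (suc n ∸ j)             ≡⟨ cong (atLeast G) (+-∸-assoc 1 (2*j<n⇒j≤n j 2j<n)) ⟩
  atLeast G (suc (n ∸ j))           ≤⟨ atLeast-isolate G u (n ∸ j) ⟩
  suc (atLeast (isolate G u) (n ∸ j)) ∎)
  where
  open ≤-Reasoning
  2[1+j]<2+n : 2 * suc j < suc (suc n)
  2[1+j]<2+n = subst (_< suc (suc n)) (sym (*-suc 2 j)) (s≤s (s≤s 2j<n))

staircase≤edges : ∀ k n (G : Graph) → StaircaseDegrees G n → staircase n k ≤ edges G
staircase≤edges zero    n       G h = z≤n
staircase≤edges (suc k) zero    G h = staircase≤edges k zero G h
staircase≤edges (suc k) (suc n) G h
  with u , high ← count-witness (order G) (h 0 (s≤s z≤n)) = begin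
  suc n + staircase (n ∸ 1) k     ≤⟨ +-mono-≤ (≤ᵇ⇒≤ (suc n) _ high)
                                       (staircase≤edges k (n ∸ 1) (isolate G u)
                                         (StaircaseDegrees-isolate (suc n) G u h)) ⟩
  degree G u + edges (isolate G u) ≤⟨ edges-isolate G u ⟩
  edges G                          ∎
  where open ≤-Reasoning

degreeSet⇒StaircaseDegrees : ∀ {m n} (G : Graph) → m ≤ n →
  HasDegreeSet G (Interval m n) → StaircaseDegrees G n
degreeSet⇒StaircaseDegrees {m} {n} G m≤n D j 2j<n with m ≤? n ∸ j
... | yes m≤n∸j = atLeast-realised G j (n ∸ j) (λ d n∸j≤d d≤n →
      from (D d) (≤-trans m≤n∸j n∸j≤d , subst (d ≤_) (m∸n+n≡m (2*j<n⇒j≤n j 2j<n)) d≤n))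
... | no  m≰n∸j = begin
  suc j             ≤⟨ s≤s (2*j<n⇒j≤n j 2j<n) ⟩
  suc n             ≤⟨ subst (_< order G) (proj₂ v-max) (degree<order G (proj₁ v-max)) ⟩
  order G           ≤⟨ atLeast-all G (n ∸ j) (λ v → ≤-trans (<⇒≤ (≰⇒> m≰n∸j))
                                             (proj₁ (to (D (degree G v)) (v , refl)))) ⟩
  atLeast G (n ∸ j) ∎
  where
  open ≤-Reasoning
  v-max : ∃ λ v → degree G v ≡ n
  v-max = from (D n) (m≤n , ≤-refl)

threshold : ℕ → Graph
threshold n = record
  { order  = suc n
  ; adj    = λ i j → not (i == j) ∧ (toℕ i + toℕ j <ᵇ suc n)
  ; sym    = λ i j → cong₂ (λ a b → not a ∧ (b <ᵇ suc n)) (==-sym i j) (+-comm (toℕ i) (toℕ j))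
  ; irrefl = λ i → cong (λ a → not a ∧ (toℕ i + toℕ i <ᵇ suc n)) (==-refl i)
  }

+-<ᵇ-∸ : ∀ x y z → (x + y <ᵇ z) ≡ (y <ᵇ z ∸ x)
+-<ᵇ-∸ zero    y z       = refl
+-<ᵇ-∸ (suc x) y zero    = refl
+-<ᵇ-∸ (suc x) y (suc z) = +-<ᵇ-∸ x y z

≮⇒<ᵇ-false : ∀ {m n} → ¬ m < n → (m <ᵇ n) ≡ false
≮⇒<ᵇ-false {m} {n} m≮n with m <ᵇ n | <ᵇ-reflects-< m n
... | false | _       = refl
... | true  | ofʸ m<n = ⊥-elim (m≮n m<n)

degree-threshold : ∀ n (i : Fin (suc n)) →
  degree (threshold n) i + ⟦ toℕ i + toℕ i <ᵇ suc n ⟧ ≡ suc n ∸ toℕ i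
degree-threshold n i = begin
  degree (threshold n) i + ⟦ toℕ i + toℕ i <ᵇ suc n ⟧
    ≡⟨ count-remove i (λ j → toℕ i + toℕ j <ᵇ suc n) ⟩
  count (suc n) (λ j → toℕ i + toℕ j <ᵇ suc n)
    ≡⟨ count-cong (suc n) (λ j → +-<ᵇ-∸ (toℕ i) (toℕ j) (suc n)) ⟩
  count (suc n) (λ j → toℕ j <ᵇ suc n ∸ toℕ i)
    ≡⟨ count-below (suc n) (suc n ∸ toℕ i) (m∸n≤m (suc n) (toℕ i)) ⟩
  suc n ∸ toℕ i ∎
  where open ≡-Reasoning

degree-threshold-low : ∀ n (i : Fin (suc n)) →
  toℕ i + toℕ i ≤ n → degree (threshold n) i ≡ n ∸ toℕ i
degree-threshold-low n i 2i≤n = suc-injective (begin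
  suc (degree (threshold n) i)
    ≡⟨ +-comm 1 _ ⟩
  degree (threshold n) i + 1
    ≡⟨ cong (λ b → degree (threshold n) i + ⟦ b ⟧) (sym (to T-≡ (<⇒<ᵇ (s≤s 2i≤n)))) ⟩
  degree (threshold n) i + ⟦ toℕ i + toℕ i <ᵇ suc n ⟧
    ≡⟨ degree-threshold n i ⟩
  suc n ∸ toℕ i
    ≡⟨ +-∸-assoc 1 (toℕ≤pred[n] i) ⟩
  suc (n ∸ toℕ i) ∎)
  where open ≡-Reasoning

degree-threshold-high : ∀ n (i : Fin (suc n)) →
  n < toℕ i + toℕ i → degree (threshold n) i ≡ suc n ∸ toℕ i
degree-threshold-high n i n<2i = begin
  degree (threshold n) i
    ≡⟨ sym (+-identityʳ _) ⟩
  degree (threshold n) i + 0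
    ≡⟨ cong (λ b → degree (threshold n) i + ⟦ b ⟧) (sym (≮⇒<ᵇ-false (<⇒≱ n<2i ∘ ≤-pred))) ⟩
  degree (threshold n) i + ⟦ toℕ i + toℕ i <ᵇ suc n ⟧
    ≡⟨ degree-threshold n i ⟩
  suc n ∸ toℕ i ∎
  where open ≡-Reasoning

threshold-degree-range : ∀ {n} → 1 ≤ n → (i : Fin (suc n)) →
  1 ≤ degree (threshold n) i × degree (threshold n) i ≤ n
threshold-degree-range {n} 1≤n i with toℕ i + toℕ i ≤? n
... | yes 2i≤n rewrite degree-threshold-low n i 2i≤n =
  m<n⇒0<n∸m (below-half (toℕ i) 2i≤n) , m∸n≤m n (toℕ i)
  where
  below-half : ∀ x → x + x ≤ n → x < n
  below-half zero    _    = 1≤n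
  below-half (suc x) 2x≤n = ≤-trans (s≤s (m≤n+m (suc x) x)) 2x≤n
... | no  2i≰n rewrite degree-threshold-high n i (≰⇒> 2i≰n) =
  m<n⇒0<n∸m (toℕ<n i) , above-half (toℕ i) 2i≰n
  where
  above-half : ∀ x → ¬ x + x ≤ n → suc n ∸ x ≤ n
  above-half zero    2x≰n = ⊥-elim (2x≰n z≤n)
  above-half (suc x) _    = m∸n≤m n x

threshold-degree-realised : ∀ {n d} → 1 ≤ d → d ≤ n → ∃ λ i → degree (threshold n) i ≡ d
threshold-degree-realised {n} {d} 1≤d d≤n with (n ∸ d) + (n ∸ d) ≤? n
... | yes 2x≤n = fromℕ< x<1+n , (begin
  degree (threshold n) (fromℕ< x<1+n) ≡⟨ degree-threshold-low n (fromℕ< x<1+n)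
                                          (subst (λ y → y + y ≤ n) (sym toℕi≡x) 2x≤n) ⟩
  n ∸ toℕ (fromℕ< x<1+n)              ≡⟨ cong (n ∸_) toℕi≡x ⟩
  n ∸ (n ∸ d)                         ≡⟨ m∸[m∸n]≡n d≤n ⟩
  d                                   ∎)
  where
  open ≡-Reasoning
  x<1+n : n ∸ d < suc n
  x<1+n = s≤s (m∸n≤m n d)
  toℕi≡x : toℕ (fromℕ< x<1+n) ≡ n ∸ d
  toℕi≡x = toℕ-fromℕ< x<1+n
... | no  2x≰n = fromℕ< 1+x<1+n , (begin
  degree (threshold n) (fromℕ< 1+x<1+n) ≡⟨ degree-threshold-high n (fromℕ< 1+x<1+n)
                                            (subst (λ y → n < y + y) (sym toℕi≡1+x) n<2[1+x]) ⟩
  suc n ∸ toℕ (fromℕ< 1+x<1+n)          ≡⟨ cong (suc n ∸_) toℕi≡1+x ⟩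
  n ∸ (n ∸ d)                           ≡⟨ m∸[m∸n]≡n d≤n ⟩
  d                                     ∎)
  where
  open ≡-Reasoning
  1+x<1+n : suc (n ∸ d) < suc n
  1+x<1+n = s≤s (∸-monoʳ-< 1≤d d≤n)
  toℕi≡1+x : toℕ (fromℕ< 1+x<1+n) ≡ suc (n ∸ d)
  toℕi≡1+x = toℕ-fromℕ< 1+x<1+n
  n<2[1+x] : n < suc (n ∸ d) + suc (n ∸ d)
  n<2[1+x] = ≤-trans (≰⇒> 2x≰n) (+-mono-≤ (n≤1+n _) (n≤1+n _))

threshold-degreeSet : ∀ {n} → 1 ≤ n → HasDegreeSet (threshold n) (Interval 1 n)
threshold-degreeSet 1≤n d = mk⇔
  (λ { (i , refl) → threshold-degree-range 1≤n i })
  (λ (1≤d , d≤n) → threshold-degree-realised 1≤d d≤n)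

row-threshold : ∀ n (i : Fin (suc n)) →
  count (suc n) (λ j → adj (threshold n) i j ∧ (toℕ i <ᵇ toℕ j)) ≤ n ∸ toℕ i ∸ toℕ i
row-threshold n i = begin
  count (suc n) (λ j → adj (threshold n) i j ∧ (x <ᵇ toℕ j))
    ≤⟨ count-mono (suc n) in-interval ⟩
  count (suc n) (λ j → (suc x ≤ᵇ toℕ j) ∧ (toℕ j <ᵇ suc n ∸ x))
    ≤⟨ count-interval (suc n) (suc x) (suc n ∸ x) ⟩
  suc n ∸ x ∸ suc x
    ≡⟨ cong (_∸ suc x) (+-∸-assoc 1 (toℕ≤pred[n] i)) ⟩
  n ∸ x ∸ x ∎
  where
  open ≤-Reasoning
  x = toℕ i
  in-interval : ∀ j → T (adj (threshold n) i j ∧ (x <ᵇ toℕ j)) →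
                      T ((suc x ≤ᵇ toℕ j) ∧ (toℕ j <ᵇ suc n ∸ x))
  in-interval j h with i~j , x<j ← to T-∧ h with _ , x+j≤n ← to (T-∧ {not (i == j)}) i~j =
    from T-∧ (x<j , subst T (+-<ᵇ-∸ x (toℕ j) (suc n)) x+j≤n)

∸-twice-suc : ∀ n y → n ∸ suc y ∸ suc y ≡ n ∸ 2 ∸ y ∸ y
∸-twice-suc n y = begin
  n ∸ suc y ∸ suc y     ≡⟨ ∸-+-assoc n (suc y) (suc y) ⟩
  n ∸ (suc y + suc y)   ≡⟨ cong (λ z → n ∸ suc z) (+-suc y y) ⟩
  n ∸ (2 + y + y)       ≡⟨ sym (∸-+-assoc n (2 + y) y) ⟩
  n ∸ (2 + y) ∸ y       ≡⟨ cong (_∸ y) (sym (∸-+-assoc n 2 y)) ⟩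
  n ∸ 2 ∸ y ∸ y         ∎
  where open ≡-Reasoning

sumFin-staircase : ∀ k n → sumFin k (λ i → n ∸ toℕ i ∸ toℕ i) ≡ staircase n k
sumFin-staircase zero    n = refl
sumFin-staircase (suc k) n =
  cong (n +_) (trans (sumFin-cong k (λ i → ∸-twice-suc n (toℕ i))) (sumFin-staircase k (n ∸ 2)))

edges-threshold : ∀ n → edges (threshold n) ≤ staircase n (suc n)
edges-threshold n =
  ≤-trans (sumFin-mono (suc n) (row-threshold n)) (≤-reflexive (sumFin-staircase (suc n) n))

proposition2 : (m n : ℕ) → 1 ≤ m → m ≤ n → (a b : ℕ)
    → IsLq (Interval m n) a → IsLq (Interval 1 n) b → b ≤ a
proposition2 m n 1≤m m≤n a b ((G , G-degrees , G-edges) , _) (_ , b-least) = begin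
  b                   ≤⟨ b-least (threshold n) (threshold-degreeSet (≤-trans 1≤m m≤n)) ⟩
  edges (threshold n) ≤⟨ edges-threshold n ⟩
  staircase n (suc n) ≤⟨ staircase≤edges (suc n) n G
                           (degreeSet⇒StaircaseDegrees G m≤n G-degrees) ⟩
  edges G             ≡⟨ G-edges ⟩
  a                   ∎
  where open ≤-Reasoning
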